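{- Let $s\le t$ be positive integers. If $H$ is an $(s,t)$-graph, then $\frac1s+\frac1t\ge\frac{v_H}{e_H}$.
   Context: $v_H,e_H$ denote the numbers of vertices and edges of $H$. An $(s,t)$-graph is a graph of minimum degree at least $s$ in which every edge contains a vertex of degree at least $t$. -}

module Defs where

open import Data.Nat using (ℕ; _+_; _*_; _≤_; _<?_)
open import Data.Bool using (Bool; true; false; if_then_else_)
open import Data.Fin using (Fin; toℕ)
open import Data.List using (List; map; allFin)
open import Data.Nat.ListAction using (sum)
open import Data.Product using (_×_)
open import Data.Sum using (_⊎_)
open import Relation.Binary.PropositionalEquality using (_≡_)
open import Relation.Nullary.Decidable using (⌊_⌋)

record SimpleGraph (n : ℕ) : Set where
  field
    adj    : Fin n → Fin n → Bool
    sym    : ∀ u v → adj u v ≡ adj v u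
    irrefl : ∀ v → adj v v ≡ false
open SimpleGraph public

vcount : ∀ {n} → SimpleGraph n → ℕ
vcount {n} _ = n

deg : ∀ {n} → SimpleGraph n → Fin n → ℕ
deg {n} G u = sum (map (λ w → if adj G u w then 1 else 0) (allFin n))

ecount : ∀ {n} → SimpleGraph n → ℕ
ecount {n} G =
  sum (map (λ u → sum (map (λ w →
         if ⌊ toℕ u <? toℕ w ⌋ then (if adj G u w then 1 else 0) else 0)
       (allFin n))) (allFin n))

IsSTGraph : ∀ {n} → ℕ → ℕ → SimpleGraph n → Set
IsSTGraph s t G =
  (∀ v → s ≤ deg G v) × (∀ u w → adj G u w ≡ true → t ≤ deg G u ⊎ t ≤ deg G w)

{-# OPTIONS --safe #-}

-- Give a vertex weight s if its degree is at least t and weight t otherwise.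
-- Then s t ≤ weight u · deg u for every vertex u, so
--   v s t ≤ Σ_u weight u · deg u = Σ_{uw ∈ E} (weight u + weight w),
-- and every edge has an endpoint of weight s while the other has weight at most t,
-- so the right-hand side is at most e (s + t).

module Submission where

open import Defs hiding (sym)
open import Data.Nat using (ℕ; _+_; _*_; _≤_; _<?_; _≤?_; z≤n)
open import Data.Nat.Properties
open import Algebra.Properties.CommutativeSemigroup +-commutativeSemigroup using (interchange)
open import Algebra.Properties.CommutativeSemigroup *-commutativeSemigroup using (x∙yz≈y∙xz)
open import Data.Bool using (true; false; if_then_else_)
open import Data.Fin using (Fin; toℕ)
open import Data.Fin.Properties using (toℕ-injective)
open import Data.List using (List; []; _∷_; map; allFin; length)
open import Data.List.Properties using (map-cong; length-tabulate)
open import Data.Nat.ListAction using (sum)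
open import Data.Product using (_,_)
open import Data.Sum using (inj₁; inj₂)
open import Function using (id)
open import Relation.Nullary using (yes; no)
open import Relation.Nullary.Decidable using (⌊_⌋)
open import Relation.Nullary.Negation using (contradiction)
open import Relation.Binary.PropositionalEquality
  using (_≡_; refl; sym; trans; cong; subst; module ≡-Reasoning)

module _ {A : Set} where

  ∑ : List A → (A → ℕ) → ℕ
  ∑ xs f = sum (map f xs)

  ∑-cong : ∀ xs {f g : A → ℕ} → (∀ x → f x ≡ g x) → ∑ xs f ≡ ∑ xs g
  ∑-cong xs f≗g = cong sum (map-cong f≗g xs)

  ∑-mono-≤ : ∀ xs {f g : A → ℕ} → (∀ x → f x ≤ g x) → ∑ xs f ≤ ∑ xs g
  ∑-mono-≤ []       f≤g = z≤n
  ∑-mono-≤ (x ∷ xs) f≤g = +-mono-≤ (f≤g x) (∑-mono-≤ xs f≤g)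

  ∑-const : ∀ xs c → ∑ xs (λ _ → c) ≡ length xs * c
  ∑-const []       c = refl
  ∑-const (x ∷ xs) c = cong (c +_) (∑-const xs c)

  ∑-distrib-+ : ∀ xs (f g : A → ℕ) → ∑ xs (λ x → f x + g x) ≡ ∑ xs f + ∑ xs g
  ∑-distrib-+ []       f g = refl
  ∑-distrib-+ (x ∷ xs) f g =
    trans (cong (f x + g x +_) (∑-distrib-+ xs f g)) (interchange (f x) (g x) (∑ xs f) (∑ xs g))

  ∑-distribˡ-* : ∀ xs k (f : A → ℕ) → ∑ xs (λ x → k * f x) ≡ k * ∑ xs f
  ∑-distribˡ-* []       k f = sym (*-zeroʳ k)
  ∑-distribˡ-* (x ∷ xs) k f =
    trans (cong (k * f x +_) (∑-distribˡ-* xs k f)) (sym (*-distribˡ-+ k (f x) (∑ xs f)))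

∑-comm : ∀ {A B : Set} (xs : List A) (ys : List B) (f : A → B → ℕ) →
         ∑ xs (λ x → ∑ ys (f x)) ≡ ∑ ys (λ y → ∑ xs (λ x → f x y))
∑-comm []       ys f = sym (trans (∑-const ys 0) (*-zeroʳ (length ys)))
∑-comm (x ∷ xs) ys f =
  trans (cong (∑ ys (f x) +_) (∑-comm xs ys f))
        (sym (∑-distrib-+ ys (f x) (λ y → ∑ xs (λ x′ → f x′ y))))

∑∑-symmetrize : ∀ {A : Set} (xs : List A) (f : A → A → ℕ) →
                2 * ∑ xs (λ x → ∑ xs (f x)) ≡ ∑ xs (λ x → ∑ xs (λ y → f x y + f y x))
∑∑-symmetrize xs f = begin
  2 * S                                                  ≡⟨ cong (S +_) (+-identityʳ S) ⟩
  S + S                                                  ≡⟨ cong (S +_) (∑-comm xs xs f) ⟩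
  S + ∑ xs (λ x → ∑ xs (λ y → f y x))                    ≡⟨ sym (∑-distrib-+ xs _ _) ⟩
  ∑ xs (λ x → ∑ xs (f x) + ∑ xs (λ y → f y x))           ≡⟨ ∑-cong xs (λ x → sym (∑-distrib-+ xs (f x) _)) ⟩
  ∑ xs (λ x → ∑ xs (λ y → f x y + f y x))                ∎
  where
  open ≡-Reasoning
  S : ℕ
  S = ∑ xs (λ x → ∑ xs (f x))

module _ {n} (G : SimpleGraph n) where

  vertices : List (Fin n)
  vertices = allFin n

  edge : Fin n → Fin n → ℕ
  edge u w = if adj G u w then 1 else 0

  edge-sym : ∀ u w → edge u w ≡ edge w u
  edge-sym u w = cong (λ b → if b then 1 else 0) (SimpleGraph.sym G u w)

  edge-irrefl : ∀ u → edge u u ≡ 0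
  edge-irrefl u = cong (λ b → if b then 1 else 0) (irrefl G u)

  orientedEdge : Fin n → Fin n → ℕ
  orientedEdge u w = if ⌊ toℕ u <? toℕ w ⌋ then edge u w else 0

  orientedEdge-symmetrize : ∀ u w → orientedEdge u w + orientedEdge w u ≡ edge u w
  orientedEdge-symmetrize u w with toℕ u <? toℕ w | toℕ w <? toℕ u
  ... | yes u<w | yes w<u = contradiction w<u (<-asym u<w)
  ... | yes _   | no _    = +-identityʳ (edge u w)
  ... | no _    | yes _   = sym (edge-sym u w)
  ... | no u≮w  | no w≮u  rewrite toℕ-injective (≤-antisym (≮⇒≥ w≮u) (≮⇒≥ u≮w)) =
    sym (edge-irrefl w)

  handshake : ∑ vertices (deg G) ≡ 2 * ecount G
  handshake = begin
    ∑ vertices (deg G)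
      ≡⟨ ∑-cong vertices (λ u → ∑-cong vertices (λ w → sym (orientedEdge-symmetrize u w))) ⟩
    ∑ vertices (λ u → ∑ vertices (λ w → orientedEdge u w + orientedEdge w u))
      ≡⟨ sym (∑∑-symmetrize vertices orientedEdge) ⟩
    2 * ecount G ∎
    where open ≡-Reasoning

  weighted-edge-≤ : (g : Fin n → ℕ) (k : ℕ) → (∀ u w → adj G u w ≡ true → g u + g w ≤ k) →
                    ∀ u w → g u * edge u w + g w * edge w u ≤ k * edge u w
  weighted-edge-≤ g k edge-bound u w rewrite edge-sym w u with adj G u w in uw
  ... | false rewrite *-zeroʳ (g u) | *-zeroʳ (g w) | *-zeroʳ k = z≤n
  ... | true  rewrite *-identityʳ (g u) | *-identityʳ (g w) | *-identityʳ k = edge-bound u w uw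

  weighted-degree-sum-≤ : (g : Fin n → ℕ) (k : ℕ) → (∀ u w → adj G u w ≡ true → g u + g w ≤ k) →
                          ∑ vertices (λ u → g u * deg G u) ≤ k * ecount G
  weighted-degree-sum-≤ g k edge-bound = *-cancelˡ-≤ 2 (begin
    2 * ∑ vertices (λ u → g u * deg G u)
      ≡⟨ cong (2 *_) (∑-cong vertices (λ u → sym (∑-distribˡ-* vertices (g u) (edge u)))) ⟩
    2 * ∑ vertices (λ u → ∑ vertices (λ w → g u * edge u w))
      ≡⟨ ∑∑-symmetrize vertices (λ u w → g u * edge u w) ⟩
    ∑ vertices (λ u → ∑ vertices (λ w → g u * edge u w + g w * edge w u))
      ≤⟨ ∑-mono-≤ vertices (λ u → ∑-mono-≤ vertices (weighted-edge-≤ g k edge-bound u)) ⟩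
    ∑ vertices (λ u → ∑ vertices (λ w → k * edge u w))
      ≡⟨ ∑-cong vertices (λ u → ∑-distribˡ-* vertices k (edge u)) ⟩
    ∑ vertices (λ u → k * deg G u)
      ≡⟨ ∑-distribˡ-* vertices k (deg G) ⟩
    k * ∑ vertices (deg G)
      ≡⟨ cong (k *_) handshake ⟩
    k * (2 * ecount G)
      ≡⟨ x∙yz≈y∙xz k 2 (ecount G) ⟩
    2 * (k * ecount G) ∎)
    where open ≤-Reasoning

module _ {n} (s t : ℕ) (G : SimpleGraph n) where

  weight : Fin n → ℕ
  weight u with t ≤? deg G u
  ... | yes _ = s
  ... | no _  = t

  weight-of-big : ∀ u → t ≤ deg G u → weight u ≡ s
  weight-of-big u t≤deg with t ≤? deg G u
  ... | yes _    = refl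
  ... | no t≰deg = contradiction t≤deg t≰deg

  weight-≤ : s ≤ t → ∀ u → weight u ≤ t
  weight-≤ s≤t u with t ≤? deg G u
  ... | yes _ = s≤t
  ... | no _  = ≤-refl

  weight-deg-≥ : IsSTGraph s t G → ∀ u → s * t ≤ weight u * deg G u
  weight-deg-≥ (min-deg , _) u with t ≤? deg G u
  ... | yes t≤deg = *-monoʳ-≤ s t≤deg
  ... | no _      = subst (_≤ t * deg G u) (*-comm t s) (*-monoʳ-≤ t (min-deg u))

  weight-edge-≤ : s ≤ t → IsSTGraph s t G → ∀ u w → adj G u w ≡ true → weight u + weight w ≤ s + t
  weight-edge-≤ s≤t (_ , big-end) u w uw with big-end u w uw
  ... | inj₁ t≤deg-u rewrite weight-of-big u t≤deg-u = +-monoʳ-≤ s (weight-≤ s≤t w)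
  ... | inj₂ t≤deg-w rewrite weight-of-big w t≤deg-w =
    subst (weight u + s ≤_) (+-comm t s) (+-monoˡ-≤ s (weight-≤ s≤t u))

lemma5p5 : (s t n : ℕ) → 1 ≤ s → s ≤ t → (H : SimpleGraph n) → IsSTGraph s t H →
    vcount H * s * t ≤ ecount H * (s + t)
lemma5p5 s t n _ s≤t H st-graph = begin
  n * s * t                                  ≡⟨ *-assoc n s t ⟩
  n * (s * t)                                ≡⟨ cong (_* (s * t)) (sym (length-tabulate {n = n} id)) ⟩
  length (vertices H) * (s * t)              ≡⟨ sym (∑-const (vertices H) (s * t)) ⟩
  ∑ (vertices H) (λ _ → s * t)               ≤⟨ ∑-mono-≤ (vertices H) (weight-deg-≥ s t H st-graph) ⟩
  ∑ (vertices H) (λ u → weight s t H u * deg H u)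
    ≤⟨ weighted-degree-sum-≤ H (weight s t H) (s + t) (weight-edge-≤ s t H s≤t st-graph) ⟩
  (s + t) * ecount H                         ≡⟨ *-comm (s + t) (ecount H) ⟩
  ecount H * (s + t)                         ∎
  where open ≤-Reasoning
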